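{- Let $S$ be a dp-dioid. Then $d(S)=\{d(x)\mid x\in S\}$ contains $0$ and $1_\sigma$, is closed under $+$ and $\cdot$, and $(d(S),+,\cdot,0,1_\sigma)$ is a bounded distributive lattice with join $+$, meet $\cdot$, least element $0$ and greatest element $1_\sigma$.
   Context: A proto-dioid is a structure $(S,+,\cdot,0,1_\sigma)$ such that $+$ is associative, commutative, idempotent with unit $0$ (order $x\le y\iff x+y=y$), and $1_\sigma\cdot x=x$, $x\cdot 1_\sigma=x$, $x\cdot y+x\cdot z\le x\cdot(y+z)$, $(x+y)\cdot z=x\cdot z+y\cdot z$, $0\cdot x=0$ (multiplication need not be associative). A dp-dioid is a proto-dioid with a unary operation $d$ such that $x\cdot(y\cdot z)=(x\cdot y)\cdot z$ whenever one of $x,y,z$ equals $d(w)$ for some $w$, and $x\le d(x)\cdot x$, $d(x\cdot y)=d(x\cdot d(y))$, $d(x+y)=d(x)+d(y)$, $d(x)\le 1_\sigma$, $d(0)=0$. -}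

module Defs where

open import Level using (Level; suc; _⊔_)
open import Data.Product using (Σ; ∃; _,_; proj₁)
open import Relation.Binary.PropositionalEquality using (_≡_)
open import Relation.Binary.Core using (Rel)
open import Algebra.Core using (Op₂)
open import Algebra.Definitions using (Identity)
open import Algebra.Lattice.Structures using (IsDistributiveLattice)

record ProtoDioid (c : Level) : Set (suc c) where
  infixl 6 _+_
  infixl 7 _·_
  infix 4 _≤_
  field
    Carrier : Set c
    _+_ : Carrier → Carrier → Carrier
    _·_ : Carrier → Carrier → Carrier
    𝟘 : Carrier
    𝟙 : Carrier

  _≤_ : Carrier → Carrier → Set c
  x ≤ y = x + y ≡ y

  field
    +-assoc : ∀ x y z → (x + y) + z ≡ x + (y + z)
    +-comm  : ∀ x y → x + y ≡ y + x
    +-idem  : ∀ x → x + x ≡ x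
    +-identityˡ : ∀ x → 𝟘 + x ≡ x
    +-identityʳ : ∀ x → x + 𝟘 ≡ x
    ·-identityˡ : ∀ x → 𝟙 · x ≡ x
    ·-identityʳ : ∀ x → x · 𝟙 ≡ x
    ·-subdistribˡ : ∀ x y z → x · y + x · z ≤ x · (y + z)
    ·-distribʳ : ∀ x y z → (x + y) · z ≡ x · z + y · z
    ·-zeroˡ : ∀ x → 𝟘 · x ≡ 𝟘

record DpDioid (c : Level) : Set (suc c) where
  field
    protoDioid : ProtoDioid c
  open ProtoDioid protoDioid public
  field
    d : Carrier → Carrier
    ·-assoc-d₁ : ∀ w y z → d w · (y · z) ≡ (d w · y) · z
    ·-assoc-d₂ : ∀ x w z → x · (d w · z) ≡ (x · d w) · z
    ·-assoc-d₃ : ∀ x y w → x · (y · d w) ≡ (x · y) · d w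
    d-absorb : ∀ x → x ≤ d x · x
    d-locality : ∀ x y → d (x · y) ≡ d (x · d y)
    d-additive : ∀ x y → d (x + y) ≡ d x + d y
    d-sub-1 : ∀ x → d x ≤ 𝟙
    d-strict : d 𝟘 ≡ 𝟘

-- Bounded distributive lattice (algebraic form): distributive lattice with
-- join ∨, meet ∧, where ⊥ is an identity for ∨ (least element) and ⊤ is an
-- identity for ∧ (greatest element).
record IsBoundedDistributiveLattice {a ℓ} {A : Set a} (_≈_ : Rel A ℓ)
       (∨ ∧ : Op₂ A) (⊥ ⊤ : A) : Set (a ⊔ ℓ) where
  field
    isDistributiveLattice : IsDistributiveLattice _≈_ ∨ ∧
    ∨-identity : Identity _≈_ ⊥ ∨
    ∧-identity : Identity _≈_ ⊤ ∧

module DomainElements {c : Level} (S : DpDioid c) where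
  open DpDioid S

  InD : Carrier → Set c
  InD a = ∃ λ x → a ≡ d x

  DS : Set c
  DS = Σ Carrier InD

  _≈D_ : DS → DS → Set c
  (a , _) ≈D (b , _) = a ≡ b

  record Closed : Set c where
    field
      𝟘∈ : InD 𝟘
      𝟙∈ : InD 𝟙
      +∈ : ∀ {a b} → InD a → InD b → InD (a + b)
      ·∈ : ∀ {a b} → InD a → InD b → InD (a · b)

  module Ops (C : Closed) where
    open Closed C
    _⊕_ : DS → DS → DS
    (a , p) ⊕ (b , q) = a + b , +∈ p q
    _⊗_ : DS → DS → DS
    (a , p) ⊗ (b , q) = a · b , ·∈ p q
    𝟘D : DS
    𝟘D = 𝟘 , 𝟘∈
    𝟙D : DS
    𝟙D = 𝟙 , 𝟙∈

-- The image d(S) is exactly the set of fixed points of d, since d is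
-- idempotent.  A fixed point a is a subidentity (a ≤ 1σ) with a · a = a,
-- and for such elements the product a · b is the greatest lower bound of a
-- and b among fixed points: d(a · b) lies below a and b, and an idempotent
-- z ≤ a, b satisfies z = z · z ≤ a · b.  Hence d(a · b) = a · b, and a · b
-- = b · a because both are that greatest lower bound.  Associativity of the
-- product comes from the d-associativity axioms, meet distributes over join
-- by right distributivity and commutativity, and the dual distributive law
-- holds in every lattice in which meet distributes over join.
module Submission where

open import Defs
open import Level using (Level)
open import Data.Product using (Σ; _,_; proj₁; proj₂)
open import Relation.Binary.PropositionalEquality
open import Relation.Binary.Bundles using (Setoid)
open import Algebra.Lattice.Structures using (IsLattice; IsDistributiveLattice)
import Algebra.Definitions as Definitions
import Algebra.Consequences.Setoid as Consequences

module ProtoDioidProperties {c : Level} (P : ProtoDioid c) where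
  open ProtoDioid P

  ≤-antisym : ∀ {x y} → x ≤ y → y ≤ x → x ≡ y
  ≤-antisym {x} {y} x≤y y≤x = trans (sym y≤x) (trans (+-comm y x) x≤y)

  ≤-trans : ∀ {x y z} → x ≤ y → y ≤ z → x ≤ z
  ≤-trans {x} {y} {z} x≤y y≤z = begin
    x + z        ≡⟨ cong (x +_) y≤z ⟨
    x + (y + z)  ≡⟨ +-assoc x y z ⟨
    (x + y) + z  ≡⟨ cong (_+ z) x≤y ⟩
    y + z        ≡⟨ y≤z ⟩
    z            ∎
    where open ≡-Reasoning

  x≤x+y : ∀ x y → x ≤ x + y
  x≤x+y x y = trans (sym (+-assoc x x y)) (cong (_+ y) (+-idem x))

  ·-monoˡ-≤ : ∀ {x y} z → x ≤ y → x · z ≤ y · z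
  ·-monoˡ-≤ {x} {y} z x≤y = trans (sym (·-distribʳ x y z)) (cong (_· z) x≤y)

  ·-monoʳ-≤ : ∀ x {y z} → y ≤ z → x · y ≤ x · z
  ·-monoʳ-≤ x {y} {z} y≤z = ≤-trans (x≤x+y (x · y) (x · z))
    (subst (λ u → x · y + x · z ≤ x · u) y≤z (·-subdistribˡ x y z))

  ·-mono-≤ : ∀ {x y u v} → x ≤ y → u ≤ v → x · u ≤ y · v
  ·-mono-≤ {y = y} {u} x≤y u≤v = ≤-trans (·-monoˡ-≤ u x≤y) (·-monoʳ-≤ y u≤v)

  ·-contractˡ : ∀ {p} y → p ≤ 𝟙 → p · y ≤ y
  ·-contractˡ {p} y p≤𝟙 = subst (p · y ≤_) (·-identityˡ y) (·-monoˡ-≤ y p≤𝟙)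

  ·-contractʳ : ∀ x {p} → p ≤ 𝟙 → x · p ≤ x
  ·-contractʳ x {p} p≤𝟙 = subst (x · p ≤_) (·-identityʳ x) (·-monoʳ-≤ x p≤𝟙)

  idem⇒·-greatest : ∀ {x y z} → z · z ≡ z → z ≤ x → z ≤ y → z ≤ x · y
  idem⇒·-greatest {x} {y} zz≡z z≤x z≤y = subst (_≤ x · y) zz≡z (·-mono-≤ z≤x z≤y)

  +-absorbs-·-subidentity : ∀ x {p} → p ≤ 𝟙 → x + x · p ≡ x
  +-absorbs-·-subidentity x {p} p≤𝟙 = trans (+-comm x (x · p)) (·-contractʳ x p≤𝟙)

module DpDioidProperties {c : Level} (S : DpDioid c) where
  open DpDioid S
  open ProtoDioidProperties protoDioid
  open DomainElements S

  d-mono : ∀ {x y} → x ≤ y → d x ≤ d y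
  d-mono {x} {y} x≤y = trans (sym (d-additive x y)) (cong d x≤y)

  d-idem : ∀ x → d (d x) ≡ d x
  d-idem x = begin
    d (d x)      ≡⟨ cong d (·-identityˡ (d x)) ⟨
    d (𝟙 · d x)  ≡⟨ d-locality 𝟙 x ⟨
    d (𝟙 · x)    ≡⟨ cong d (·-identityˡ x) ⟩
    d x          ∎
    where open ≡-Reasoning

  d-𝟙 : d 𝟙 ≡ 𝟙
  d-𝟙 = ≤-antisym (d-sub-1 𝟙) (subst (𝟙 ≤_) (·-identityʳ (d 𝟙)) (d-absorb 𝟙))

  IsDomain : Carrier → Set c
  IsDomain a = d a ≡ a

  InD⇒IsDomain : ∀ {a} → InD a → IsDomain a
  InD⇒IsDomain (x , refl) = d-idem x

  IsDomain⇒InD : ∀ {a} → IsDomain a → InD a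
  IsDomain⇒InD {a} da≡a = a , sym da≡a

  domain-≤-𝟙 : ∀ {a} → IsDomain a → a ≤ 𝟙
  domain-≤-𝟙 {a} da≡a = subst (_≤ 𝟙) da≡a (d-sub-1 a)

  domain-·-idem : ∀ {a} → IsDomain a → a · a ≡ a
  domain-·-idem {a} da≡a = ≤-antisym (·-contractʳ a (domain-≤-𝟙 da≡a))
    (subst (λ u → a ≤ u · a) da≡a (d-absorb a))

  domain-+ : ∀ {a b} → IsDomain a → IsDomain b → IsDomain (a + b)
  domain-+ {a} {b} da≡a db≡b = trans (d-additive a b) (cong₂ _+_ da≡a db≡b)

  domain-· : ∀ {a b} → IsDomain a → IsDomain b → IsDomain (a · b)
  domain-· {a} {b} da≡a db≡b = ≤-antisym d[ab]≤ab ab≤d[ab]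
    where
    d[ab]≤ab : d (a · b) ≤ a · b
    d[ab]≤ab = idem⇒·-greatest (domain-·-idem (d-idem (a · b)))
      (subst (d (a · b) ≤_) da≡a (d-mono (·-contractʳ a (domain-≤-𝟙 db≡b))))
      (subst (d (a · b) ≤_) db≡b (d-mono (·-contractˡ b (domain-≤-𝟙 da≡a))))
    ab≤d[ab] : a · b ≤ d (a · b)
    ab≤d[ab] = ≤-trans (d-absorb (a · b)) (·-contractʳ (d (a · b))
      (≤-trans (·-contractˡ b (domain-≤-𝟙 da≡a)) (domain-≤-𝟙 db≡b)))

  domain-·-comm : ∀ {a b} → IsDomain a → IsDomain b → a · b ≡ b · a
  domain-·-comm {a} {b} da≡a db≡b = ≤-antisym (swap-≤ a b da≡a db≡b) (swap-≤ b a db≡b da≡a)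
    where
    swap-≤ : ∀ x y → IsDomain x → IsDomain y → x · y ≤ y · x
    swap-≤ x y dx≡x dy≡y = idem⇒·-greatest (domain-·-idem (domain-· dx≡x dy≡y))
      (·-contractˡ y (domain-≤-𝟙 dx≡x)) (·-contractʳ x (domain-≤-𝟙 dy≡y))

  domain-·-assoc : ∀ {a} b c → IsDomain a → (a · b) · c ≡ a · (b · c)
  domain-·-assoc {a} b c da≡a = begin
    (a · b) · c    ≡⟨ cong (λ u → (u · b) · c) da≡a ⟨
    (d a · b) · c  ≡⟨ ·-assoc-d₁ a b c ⟨
    d a · (b · c)  ≡⟨ cong (_· (b · c)) da≡a ⟩
    a · (b · c)    ∎
    where open ≡-Reasoning

  domain-·-absorbs-+ : ∀ {a b} → IsDomain a → IsDomain b → a · (a + b) ≡ a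
  domain-·-absorbs-+ {a} {b} da≡a db≡b = ≤-antisym
    (·-contractʳ a (domain-≤-𝟙 (domain-+ da≡a db≡b)))
    (subst (_≤ a · (a + b)) (domain-·-idem da≡a) (·-monoʳ-≤ a (x≤x+y a b)))

  closed : Closed
  closed = record
    { 𝟘∈ = 𝟘 , sym d-strict
    ; 𝟙∈ = 𝟙 , sym d-𝟙
    ; +∈ = λ p q → IsDomain⇒InD (domain-+ (InD⇒IsDomain p) (InD⇒IsDomain q))
    ; ·∈ = λ p q → IsDomain⇒InD (domain-· (InD⇒IsDomain p) (InD⇒IsDomain q))
    }

  open Ops closed
  open Definitions _≈D_

  isDomain : (u : DS) → IsDomain (proj₁ u)
  isDomain u = InD⇒IsDomain (proj₂ u)

  ≈D-setoid : Setoid c c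
  ≈D-setoid = record
    { Carrier       = DS
    ; _≈_           = _≈D_
    ; isEquivalence = record { refl = refl ; sym = sym ; trans = trans }
    }

  ⊗-comm : Commutative _⊗_
  ⊗-comm u v = domain-·-comm (isDomain u) (isDomain v)

  ⊕-⊗-isLattice : IsLattice _≈D_ _⊕_ _⊗_
  ⊕-⊗-isLattice = record
    { isEquivalence = Setoid.isEquivalence ≈D-setoid
    ; ∨-comm        = λ u v → +-comm (proj₁ u) (proj₁ v)
    ; ∨-assoc       = λ u v w → +-assoc (proj₁ u) (proj₁ v) (proj₁ w)
    ; ∨-cong        = cong₂ _+_
    ; ∧-comm        = ⊗-comm
    ; ∧-assoc       = λ u v w → domain-·-assoc (proj₁ v) (proj₁ w) (isDomain u)
    ; ∧-cong        = cong₂ _·_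
    ; absorptive    = (λ u v → +-absorbs-·-subidentity (proj₁ u) (domain-≤-𝟙 (isDomain v)))
                    , (λ u v → domain-·-absorbs-+ (isDomain u) (isDomain v))
    }

  ⊕-⊗-isDistributiveLattice : IsDistributiveLattice _≈D_ _⊕_ _⊗_
  ⊕-⊗-isDistributiveLattice = record
    { isLattice   = ⊕-⊗-isLattice
    ; ∨-distrib-∧ = comm∧distrˡ⇒distr {_⊕_} {_⊗_} (λ {u v w z} → ∧-cong {u} {v} {w} {z}) ∨-comm
        (distrib∧absorbs⇒distribˡ {_⊕_} {_⊗_} (λ {u v w z} → ∨-cong {u} {v} {w} {z})
          ∨-assoc ∧-comm ∨-absorbs-∧ ∧-absorbs-∨ ⊗-distrib-⊕)
    ; ∧-distrib-∨ = ⊗-distrib-⊕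
    }
    where
    open IsLattice ⊕-⊗-isLattice
    open Consequences ≈D-setoid
    -- u ≈D v only constrains the first components of u and v, so the
    -- implicit arguments of a congruence cannot be inferred from its
    -- hypotheses; hence the eta-expanded congruences passed here and above.
    ⊗-distrib-⊕ : _⊗_ DistributesOver _⊕_
    ⊗-distrib-⊕ = comm∧distrʳ⇒distr {_⊗_} {_⊕_} (λ {u v w z} → ∨-cong {u} {v} {w} {z}) ⊗-comm
      (λ u v w → ·-distribʳ (proj₁ v) (proj₁ w) (proj₁ u))

  isBoundedDistributiveLattice : IsBoundedDistributiveLattice _≈D_ _⊕_ _⊗_ 𝟘D 𝟙D
  isBoundedDistributiveLattice = record
    { isDistributiveLattice = ⊕-⊗-isDistributiveLattice
    ; ∨-identity = (λ u → +-identityˡ (proj₁ u)) , (λ u → +-identityʳ (proj₁ u))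
    ; ∧-identity = (λ u → ·-identityˡ (proj₁ u)) , (λ u → ·-identityʳ (proj₁ u))
    }

proposition8p4 : ∀ {c : Level} (S : DpDioid c) →
    Σ (DomainElements.Closed S) λ C →
      IsBoundedDistributiveLattice (DomainElements._≈D_ S)
        (DomainElements.Ops._⊕_ S C) (DomainElements.Ops._⊗_ S C)
        (DomainElements.Ops.𝟘D S C) (DomainElements.Ops.𝟙D S C)
proposition8p4 S = closed , isBoundedDistributiveLattice
  where open DpDioidProperties S
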